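{- Let $\phi$ be a frugal monodic standpoint $\mathcal{C}^2$ formula, let $\mathfrak{M}$ be a standpoint structure over $\langle\mathbf{P}\uplus\mathbf{P}_{\mathtt{E}},\emptyset,\{*\}\rangle$ as below, and let $\langle\mathfrak{M}\rangle_{\mathbf{P}_{\mathtt{E}}}$ be its $\mathbf{P}_{\mathtt{E}}$-stable permutational closure. Let $(\pi,f)$ and $(\pi,f')$ be precisifications of $\langle\mathfrak{M}\rangle_{\mathbf{P}_{\mathtt{E}}}$, let $v$ be a variable assignment and $v'=f'\circ f^{ -1}\circ v$. Then $\langle\mathfrak{M}\rangle_{\mathbf{P}_{\mathtt{E}}},(\pi,f),v\models\phi$ if and only if $\langle\mathfrak{M}\rangle_{\mathbf{P}_{\mathtt{E}}},(\pi,f'),v'\models\phi$.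
   Context: FOSL over a signature with only standpoint $*$: formulae $\phi ::= P(t_1,\dots)\mid t_1\doteq t_2\mid\neg\phi\mid\phi\wedge\psi\mid\exists^{\lhd n}x.\phi\mid\Diamond_*\phi$ ($\lhd\in\{\le,=,\ge\}$). A standpoint structure $\langle\Delta,\Pi,\sigma,\gamma\rangle$: nonempty domain, nonempty precisifications, $\sigma(*)=\Pi$, $\gamma(\pi)$ a first-order structure over $\Delta$; $\exists^{\lhd n}x.\phi$ holds at $(\pi,v)$ iff the number of $\delta$ with $\phi$ true at $(\pi,v[x\mapsto\delta])$ is $\lhd n$; $\Diamond_*\phi$ holds at $(\pi,v)$ iff $\phi$ holds at $(\pi',v)$ for some $\pi'$. A frugal monodic standpoint $\mathcal{C}^2$ formula uses only variables $x,y$, only unary and binary predicates, no constants, only standpoint $*$, and in each subformula $\Diamond_*\psi$, $\psi$ has at most one free variable. A predicate is rigid if interpreted identically in all precisifications ($P^{\mathfrak{M}}$ denotes this interpretation). $\mathbf{P}_{\mathtt{E}}$-stable permutational closure: let $\mathfrak{M}=\langle\Delta,\Pi,\sigma,\gamma\rangle$ be over $\langle\mathbf{P}\uplus\mathbf{P}_{\mathtt{E}},\emptyset,\{*\}\rangle$, $\mathbf{P}$ consisting of unary and binary predicates and $\mathbf{P}_{\mathtt{E}}$ of rigid unary predicates. Let $\mathbb{P}_{\mathtt{E}}$ be the set of bijections $f:\Delta\to\Delta$ with $\delta\in\mathtt{E}^{\mathfrak{M}}\Leftrightarrow f(\delta)\in\mathtt{E}^{\mathfrak{M}}$ for all $\mathtt{E}\in\mathbf{P}_{\mathtt{E}}$,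 $\delta\in\Delta$. Then $\langle\mathfrak{M}\rangle_{\mathbf{P}_{\mathtt{E}}}=\langle\Delta,\Pi\times\mathbb{P}_{\mathtt{E}},\sigma',\gamma'\rangle$ with $\sigma'(*)=\Pi\times\mathbb{P}_{\mathtt{E}}$, $P^{\gamma'((\pi,f))}=\{f(\delta)\mid\delta\in P^{\gamma(\pi)}\}$ for unary $P\in\mathbf{P}$, $P^{\gamma'((\pi,f))}=\{(f(\delta_1),f(\delta_2))\mid(\delta_1,\delta_2)\in P^{\gamma(\pi)}\}$ for binary $P\in\mathbf{P}$, and predicates of $\mathbf{P}_{\mathtt{E}}$ keeping their (rigid) interpretation. -}

module Defs where

open import Data.Nat using (ℕ; suc)
open import Data.Fin using (Fin)
open import Data.Product using (Σ; _×_; _,_; ∃)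
open import Data.Empty using (⊥)
open import Data.Unit using (⊤)
open import Relation.Nullary using (¬_)
open import Relation.Binary.PropositionalEquality using (_≡_)
open import Function.Bundles using (_↔_; _⇔_; Inverse)
open import Function.Definitions using (Injective)
open import Function.Construct.Identity using (↔-id)

-- Syntax of frugal monodic standpoint C² formulas over the signature
-- ⟨ P ⊎ P_E , ∅ , {*} ⟩ :  U = unary predicates of P, B = binary
-- predicates of P, E = the rigid unary predicates of P_E.

data Var : Set where
  x y : Var

data Cmp : Set where
  le eq ge : Cmp

data Fm (U B E : Set) : Set where
  unA  : U → Var → Fm U B E
  binA : B → Var → Var → Fm U B E
  extA : E → Var → Fm U B E
  eqA  : Var → Var → Fm U B E
  neg  : Fm U B E → Fm U B E
  conj : Fm U B E → Fm U B E → Fm U B E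
  cnt  : Cmp → ℕ → Var → Fm U B E → Fm U B E
  dia  : Fm U B E → Fm U B E

data Free {U B E : Set} (z : Var) : Fm U B E → Set where
  fUn   : ∀ {P} → Free z (unA P z)
  fBin₁ : ∀ {P w} → Free z (binA P z w)
  fBin₂ : ∀ {P w} → Free z (binA P w z)
  fExt  : ∀ {P} → Free z (extA P z)
  fEq₁  : ∀ {w} → Free z (eqA z w)
  fEq₂  : ∀ {w} → Free z (eqA w z)
  fNeg  : ∀ {φ} → Free z φ → Free z (neg φ)
  fAnd₁ : ∀ {φ ψ} → Free z φ → Free z (conj φ ψ)
  fAnd₂ : ∀ {φ ψ} → Free z ψ → Free z (conj φ ψ)
  fCnt  : ∀ {c n w φ} → ¬ (z ≡ w) → Free z φ → Free z (cnt c n w φ)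
  fDia  : ∀ {φ} → Free z φ → Free z (dia φ)

AtMostOneFree : {U B E : Set} → Fm U B E → Set
AtMostOneFree φ = ¬ (Free x φ × Free y φ)

Frugal : {U B E : Set} → Fm U B E → Set
Frugal (unA _ _)     = ⊤
Frugal (binA _ _ _)  = ⊤
Frugal (extA _ _)    = ⊤
Frugal (eqA _ _)     = ⊤
Frugal (neg φ)       = Frugal φ
Frugal (conj φ ψ)    = Frugal φ × Frugal ψ
Frugal (cnt _ _ _ φ) = Frugal φ
Frugal (dia ψ)       = AtMostOneFree ψ × Frugal ψ

-- Standpoint structures over ⟨ P ⊎ P_E , ∅ , {*} ⟩ with σ(*) = Π.

record SStruct (U B E : Set) : Set₁ where
  field
    Δ    : Set
    Π    : Set
    δ₀   : Δ
    π₀   : Π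
    uI   : Π → U → Δ → Set
    bI   : Π → B → Δ → Δ → Set
    eI   : Π → E → Δ → Set
open SStruct public

RigidE : {U B E : Set} → SStruct U B E → Set
RigidE M = ∀ π π' e d → eI M π e d ⇔ eI M π' e d

Assignment : {U B E : Set} → SStruct U B E → Set
Assignment M = Var → Δ M

_[_↦_] : {A : Set} → (Var → A) → Var → A → (Var → A)
(v [ x ↦ a ]) x = a
(v [ x ↦ a ]) y = v y
(v [ y ↦ a ]) x = v x
(v [ y ↦ a ]) y = a

AtLeast : {A : Set} → ℕ → (A → Set) → Set
AtLeast {A} n Q = Σ (Fin n → A) λ g → Injective _≡_ _≡_ g × (∀ i → Q (g i))

AtMost : {A : Set} → ℕ → (A → Set) → Set
AtMost n Q = ¬ AtLeast (suc n) Q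

Count : {A : Set} → Cmp → ℕ → (A → Set) → Set
Count le n Q = AtMost n Q
Count eq n Q = AtLeast n Q × AtMost n Q
Count ge n Q = AtLeast n Q

Sat : {U B E : Set} (M : SStruct U B E) → Π M → Assignment M → Fm U B E → Set
Sat M π v (unA P z)      = uI M π P (v z)
Sat M π v (binA P z w)   = bI M π P (v z) (v w)
Sat M π v (extA P z)     = eI M π P (v z)
Sat M π v (eqA z w)      = v z ≡ v w
Sat M π v (neg φ)        = ¬ Sat M π v φ
Sat M π v (conj φ ψ)     = Sat M π v φ × Sat M π v ψ
Sat M π v (cnt c n z φ)  = Count c n (λ d → Sat M π (v [ z ↦ d ]) φ)
Sat M π v (dia φ)        = Σ (Π M) λ π' → Sat M π' v φ

-- E^M, the (rigid) interpretation of E in M (read off at π₀)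
E^ : {U B E : Set} (M : SStruct U B E) → E → Δ M → Set
E^ M e d = eI M (π₀ M) e d

StablePerm : {U B E : Set} → SStruct U B E → Set
StablePerm M =
  Σ (Δ M ↔ Δ M) λ f → ∀ e d → E^ M e d ⇔ E^ M e (Inverse.to f d)

idStable : {U B E : Set} (M : SStruct U B E) → StablePerm M
idStable M = ↔-id (Δ M) , λ e d → Function.Construct.Identity.⇔-id (E^ M e d)
  where import Function.Construct.Identity

closure : {U B E : Set} → SStruct U B E → SStruct U B E
closure M = record
  { Δ  = Δ M
  ; Π  = Π M × StablePerm M
  ; δ₀ = δ₀ M
  ; π₀ = π₀ M , idStable M
  ; uI = λ { (π , f) P d → Σ (Δ M) λ d₀ → uI M π P d₀ × Inverse.to (Data.Product.proj₁ f) d₀ ≡ d }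
  ; bI = λ { (π , f) P d₁ d₂ → Σ (Δ M × Δ M) λ { (e₁ , e₂) → bI M π P e₁ e₂
                 × (Inverse.to (Data.Product.proj₁ f) e₁ ≡ d₁ × Inverse.to (Data.Product.proj₁ f) e₂ ≡ d₂) } }
  ; eI = λ { (π , f) e d → eI M π e d }
  }
  where import Data.Product

-- A stable permutation g of the domain is an automorphism of the closure: it fixes the
-- rigid predicates and carries the precisification (π , f) to (π , g ∘ f), while
-- (π , g ∘ h) ranges over all precisifications as h does.  Hence, by induction on φ,
-- truth at (π , f) under v equals truth at (π , g ∘ f) under g ∘ v; the lemma is the
-- case g = f' ∘ f⁻¹.  The argument never uses frugality: it holds for every formula.
module Submission where

open import Defs
open import Data.Product using (_×_; _,_; proj₁; proj₂; map₂)
open import Data.Product.Function.NonDependent.Propositional using (_×-⇔_)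
import Data.Product.Function.Dependent.Propositional as Σ
open import Function using (_∘_)
open import Function.Bundles using (_↔_; _↣_; _⇔_; Inverse; Injection; Equivalence; mk⇔)
open import Function.Construct.Composition using (_↔-∘_; _⇔-∘_)
open import Function.Construct.Symmetry using (↔-sym; ⇔-sym)
open import Function.Properties.Inverse using (↔⇒↣)
open import Function.Related.TypeIsomorphisms using (¬-cong-⇔)
open import Relation.Binary.PropositionalEquality
  using (_≡_; refl; sym; trans; cong; subst)

open Equivalence using (to; from)

AtLeast-map : {A B : Set} {P : A → Set} {Q : B → Set} (g : A ↣ B) →
              (∀ a → P a → Q (Injection.to g a)) → ∀ n → AtLeast n P → AtLeast n Q
AtLeast-map g P⇒Q n (w , w-inj , w-P) =
  Injection.to g ∘ w , w-inj ∘ Injection.injective g , λ i → P⇒Q (w i) (w-P i)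

AtLeast-↔ : {A B : Set} {P : A → Set} {Q : B → Set} (g : A ↔ B) →
            (∀ a → P a ⇔ Q (Inverse.to g a)) → ∀ n → AtLeast n P ⇔ AtLeast n Q
AtLeast-↔ {P = P} {Q} g P⇔Q n =
  mk⇔ (AtLeast-map {Q = Q} (↔⇒↣ g) (to ∘ P⇔Q) n)
      (AtLeast-map {Q = P} (↔⇒↣ (↔-sym g)) Q⇒P n)
  where
  Q⇒P : ∀ b → Q b → P (Inverse.from g b)
  Q⇒P b q = from (P⇔Q _) (subst Q (sym (Inverse.strictlyInverseˡ g b)) q)

Count-↔ : {A B : Set} {P : A → Set} {Q : B → Set} (g : A ↔ B) →
          (∀ a → P a ⇔ Q (Inverse.to g a)) → ∀ c n → Count c n P ⇔ Count c n Q
Count-↔ {P = P} {Q} g P⇔Q c n = count c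
  where
  atLeast : ∀ m → AtLeast m P ⇔ AtLeast m Q
  atLeast = AtLeast-↔ {Q = Q} g P⇔Q

  count : ∀ c → Count c n P ⇔ Count c n Q
  count le = ¬-cong-⇔ (atLeast _)
  count eq = atLeast n ×-⇔ ¬-cong-⇔ (atLeast _)
  count ge = atLeast n

≡-transport : {A B : Set} (g : A ↣ B) {a b : A} {a' b' : B} →
              a' ≡ Injection.to g a → b' ≡ Injection.to g b → (a ≡ b) ⇔ (a' ≡ b')
≡-transport g a'≡ga b'≡gb = mk⇔
  (λ a≡b → trans a'≡ga (trans (cong (Injection.to g) a≡b) (sym b'≡gb)))
  (λ a'≡b' → Injection.injective g (trans (sym a'≡ga) (trans a'≡b' b'≡gb)))

[↦]-map : {A B : Set} (g : A → B) {v : Var → A} {v' : Var → B} →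
          (∀ z → v' z ≡ g (v z)) → ∀ z a w → (v' [ z ↦ g a ]) w ≡ g ((v [ z ↦ a ]) w)
[↦]-map g v'≡gv x a x = refl
[↦]-map g v'≡gv x a y = v'≡gv y
[↦]-map g v'≡gv y a x = v'≡gv x
[↦]-map g v'≡gv y a y = refl

module _ {U B E : Set} (M : SStruct U B E) where

  perm : StablePerm M → Δ M ↔ Δ M
  perm = proj₁

  apply : StablePerm M → Δ M → Δ M
  apply g = Inverse.to (perm g)

  stable-∘ : StablePerm M → StablePerm M → StablePerm M
  stable-∘ g h = perm g ↔-∘ perm h , λ e d → proj₂ g e (apply h d) ⇔-∘ proj₂ h e d

  stable-sym : StablePerm M → StablePerm M
  stable-sym g = ↔-sym (perm g) , λ e d →
    ⇔-sym (subst (λ d' → E^ M e (Inverse.from (perm g) d) ⇔ E^ M e d')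
                 (Inverse.strictlyInverseˡ (perm g) d) (proj₂ g e (Inverse.from (perm g) d)))

  stable-rigid : RigidE M → (g : StablePerm M) → ∀ π e d → eI M π e d ⇔ eI M π e (apply g d)
  stable-rigid rigid g π e d =
    rigid (π₀ M) π e (apply g d) ⇔-∘ (proj₂ g e d ⇔-∘ rigid π (π₀ M) e d)

  module _ (rigid : RigidE M) (g : StablePerm M) where

    private
      g↣ : Δ M ↣ Δ M
      g↣ = ↔⇒↣ (perm g)

    -- The hypotheses are pointwise equations rather than f' = g ∘ f and v' = g ∘ v, because
    -- in the ◇ case the inverse direction produces g ∘ (g⁻¹ ∘ h'), which equals h' only pointwise.
    Sat-transport :
      (φ : Fm U B E) (π : Π M) (f f' : StablePerm M) →
      (∀ d → apply f' d ≡ apply g (apply f d)) →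
      (v v' : Var → Δ M) → (∀ z → v' z ≡ apply g (v z)) →
      Sat (closure M) (π , f) v φ ⇔ Sat (closure M) (π , f') v' φ
    Sat-transport (unA P z) π f f' f'≡gf v v' v'≡gv =
      Σ.congˡ λ {d} → mk⇔ (map₂ (to (≡-transport g↣ (f'≡gf d) (v'≡gv z))))
                          (map₂ (from (≡-transport g↣ (f'≡gf d) (v'≡gv z))))
    Sat-transport (binA P z w) π f f' f'≡gf v v' v'≡gv =
      Σ.congˡ λ { {d₁ , d₂} → mk⇔ (map₂ (to (atoms d₁ d₂))) (map₂ (from (atoms d₁ d₂))) }
      where
      atoms : ∀ d₁ d₂ → (apply f d₁ ≡ v z × apply f d₂ ≡ v w)
                      ⇔ (apply f' d₁ ≡ v' z × apply f' d₂ ≡ v' w)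
      atoms d₁ d₂ = ≡-transport g↣ (f'≡gf d₁) (v'≡gv z) ×-⇔ ≡-transport g↣ (f'≡gf d₂) (v'≡gv w)
    Sat-transport (extA e z) π f f' f'≡gf v v' v'≡gv =
      subst (λ d → eI M π e (v z) ⇔ eI M π e d) (sym (v'≡gv z)) (stable-rigid rigid g π e (v z))
    Sat-transport (eqA z w) π f f' f'≡gf v v' v'≡gv = ≡-transport g↣ (v'≡gv z) (v'≡gv w)
    Sat-transport (neg φ) π f f' f'≡gf v v' v'≡gv =
      ¬-cong-⇔ (Sat-transport φ π f f' f'≡gf v v' v'≡gv)
    Sat-transport (conj φ ψ) π f f' f'≡gf v v' v'≡gv =
      Sat-transport φ π f f' f'≡gf v v' v'≡gv ×-⇔ Sat-transport ψ π f f' f'≡gf v v' v'≡gv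
    Sat-transport (cnt c n z φ) π f f' f'≡gf v v' v'≡gv =
      Count-↔ (perm g)
        (λ d → Sat-transport φ π f f' f'≡gf (v [ z ↦ d ]) (v' [ z ↦ apply g d ])
                             ([↦]-map (apply g) v'≡gv z d))
        c n
    Sat-transport (dia φ) π f f' f'≡gf v v' v'≡gv = mk⇔
      (λ { ((π' , h) , sat) →
             (π' , stable-∘ g h) , to (Sat-transport φ π' h (stable-∘ g h) (λ _ → refl) v v' v'≡gv) sat })
      (λ { ((π' , h') , sat) →
             (π' , stable-∘ (stable-sym g) h') ,
             from (Sat-transport φ π' (stable-∘ (stable-sym g) h') h'
                      (λ d → sym (Inverse.strictlyInverseˡ (perm g) (apply h' d))) v v' v'≡gv) sat })

lemma2 : {U B E : Set} (M : SStruct U B E) → RigidE M →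
         (φ : Fm U B E) → Frugal φ →
         (π : Π M) (f f' : StablePerm M) (v : Var → Δ M) →
         Sat (closure M) (π , f) v φ
           ⇔ Sat (closure M) (π , f') (λ z → Inverse.to (proj₁ f') (Inverse.from (proj₁ f) (v z))) φ
lemma2 M rigid φ _ π f f' v =
  Sat-transport M rigid (stable-∘ M f' (stable-sym M f)) φ π f f'
    (λ d → cong (Inverse.to (proj₁ f')) (sym (Inverse.strictlyInverseʳ (proj₁ f) d)))
    v _ (λ _ → refl)
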